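{- Let $C$ be a satisfiable $\mathcal{ALC}\iota$ concept. Then there exists a model $\mathcal{I}$ of $C$ (an interpretation with $C^{\mathcal{I}}\neq\emptyset$) whose domain has size at most exponential in $|C|$.
   Context: $\mathcal{ALC}\iota$ concepts: $C ::= A \mid \neg C \mid (C\sqcap C) \mid \exists r.C \mid \{\iota C\} \mid \iota C.C$ ($A$ atomic concept, $r$ role). Semantics over interpretations $\mathcal{I}=(\Delta^{\mathcal{I}},\cdot^{\mathcal{I}})$: standard for $\neg,\sqcap,\exists r$; $(\{\iota C\})^{\mathcal{I}}=\{d\}$ if $C^{\mathcal{I}}=\{d\}$, else $\emptyset$; $(\iota C.D)^{\mathcal{I}}=\Delta^{\mathcal{I}}$ if $C^{\mathcal{I}}=\{d\}\subseteq D^{\mathcal{I}}$ for some $d$, else $\emptyset$. $|C|$ is the number of symbols in $C$ excluding parentheses. -}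

module Defs where

open import Data.Nat using (ℕ; suc; _+_)
open import Data.Product using (Σ; ∃; _×_; _,_)
open import Data.Empty using (⊥)
open import Relation.Nullary using (¬_)
open import Relation.Binary.PropositionalEquality using (_≡_)

ConceptName : Set
ConceptName = ℕ

RoleName : Set
RoleName = ℕ

data Concept : Set where
  atom : ConceptName → Concept
  ¬c_  : Concept → Concept
  _⊓_  : Concept → Concept → Concept
  ∃[_]_ : RoleName → Concept → Concept
  ｛ι_｝ : Concept → Concept
  ι_∙_ : Concept → Concept → Concept

record Interp (Δ : Set) : Set₁ where
  field
    conceptI : ConceptName → Δ → Set
    roleI    : RoleName → Δ → Δ → Set
open Interp public

IsSingleton : {Δ : Set} → (Δ → Set) → Δ → Set
IsSingleton P d = P d × (∀ e → P e → e ≡ d)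

⟦_⟧ : Concept → {Δ : Set} → Interp Δ → Δ → Set
⟦ atom A ⟧ I x = conceptI I A x
⟦ ¬c C ⟧ I x = ¬ (⟦ C ⟧ I x)
⟦ C ⊓ D ⟧ I x = ⟦ C ⟧ I x × ⟦ D ⟧ I x
⟦ ∃[ r ] C ⟧ I x = ∃ λ y → roleI I r x y × ⟦ C ⟧ I y
⟦ ｛ι C ｝ ⟧ I x = IsSingleton (⟦ C ⟧ I) x
⟦ ι C ∙ D ⟧ {Δ} I x = Σ Δ λ d → IsSingleton (⟦ C ⟧ I) d × ⟦ D ⟧ I d

-- |C|: number of symbols, parentheses excluded.
-- A:1; ¬C: 1+|C|; C⊓D: 1+|C|+|D|; ∃r.C: 3+|C| (∃, r, .);
-- {ιC}: 3+|C| ({, ι, }); ιC.D: 2+|C|+|D| (ι, .)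
size : Concept → ℕ
size (atom A) = 1
size (¬c C) = suc (size C)
size (C ⊓ D) = suc (size C + size D)
size (∃[ r ] C) = 3 + size C
size ｛ι C ｝ = 3 + size C
size (ι C ∙ D) = 2 + size C + size D

Satisfiable : Concept → Set₁
Satisfiable C = Σ Set λ Δ → Σ (Interp Δ) λ I → ∃ λ d → ⟦ C ⟧ I d

{-# OPTIONS --safe #-}
module Submission where

-- Filtration. Call two elements of a model equivalent when they satisfy the same
-- subconcepts of C; there are at most 2^|C| classes. Keep two elements of every class
-- realised at least twice and one of every class realised once, and relate two kept
-- elements by r whenever some elements of their classes are related by r. Existential
-- restrictions are preserved because every class is still represented, and definite
-- descriptions because a class has a single element in the new model exactly when it
-- had a single element in the old one. The new model has at most 2 * 2^|C| elements.

open import Defs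
open import Data.Nat using (ℕ; zero; suc; _+_; _*_; _^_; _≤_; z≤n; s≤s; NonZero; >-nonZero⁻¹)
open import Data.Nat.Properties
  using ( ≤-refl; ≤-trans; ≤-reflexive; +-mono-≤; +-monoˡ-≤; *-monoʳ-≤; ^-monoʳ-≤; m≤n+m; m≤m*n
        ; +-identityʳ; *-identityʳ; *-suc; module ≤-Reasoning)
open import Data.Fin using (Fin; zero; suc; combine; remQuot)
open import Data.Fin.Properties using (remQuot-combine)
open import Data.Product using (Σ; ∃; ∃₂; _×_; _,_; proj₁; proj₂)
open import Data.Product.Function.NonDependent.Propositional using (_×-⇔_)
open import Data.List using (List; []; _∷_; _++_; length; lookup; concatMap; allFin; deduplicate)
open import Data.List.Properties using (length-++; length-tabulate; length-deduplicate)
open import Data.List.Membership.Propositional using (_∈_)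
open import Data.List.Membership.Propositional.Properties
  using (∈-++⁺ˡ; ∈-++⁺ʳ; ∈-map⁺; ∈-concat⁺′; ∈-allFin; ∈-lookup; ∈-deduplicate⁺)
open import Data.List.Relation.Binary.Subset.Propositional using (_⊆_)
open import Data.List.Relation.Unary.Any using (here; there; index)
open import Data.List.Relation.Unary.Any.Properties using (lookup-index)
open import Data.List.Relation.Unary.All as All using (All)
open import Data.List.Relation.Unary.AllPairs using (_∷_)
open import Data.List.Relation.Unary.Unique.Propositional using (Unique)
open import Data.List.Relation.Unary.Unique.DecPropositional.Properties using (deduplicate-!)
open import Function using (_∘_; id; _⇔_; mk⇔; Equivalence)
open import Function.Definitions using (Injective)
open import Level using (0ℓ)
open import Axiom.ExcludedMiddle using (ExcludedMiddle)
open import Relation.Nullary using (Dec; yes; no; contradiction)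
open import Relation.Binary.PropositionalEquality using (_≡_; _≢_; refl; sym; trans; cong)

open Equivalence using (to; from)

subconcepts : Concept → List Concept
subconcepts (atom A)   = atom A ∷ []
subconcepts (¬c C)     = ¬c C ∷ subconcepts C
subconcepts (C ⊓ D)    = C ⊓ D ∷ subconcepts C ++ subconcepts D
subconcepts (∃[ r ] C) = ∃[ r ] C ∷ subconcepts C
subconcepts ｛ι C ｝    = ｛ι C ｝ ∷ subconcepts C
subconcepts (ι C ∙ D)  = ι C ∙ D ∷ subconcepts C ++ subconcepts D

∈-subconcepts : ∀ C → C ∈ subconcepts C
∈-subconcepts (atom A)   = here refl
∈-subconcepts (¬c C)     = here refl
∈-subconcepts (C ⊓ D)    = here refl
∈-subconcepts (∃[ r ] C) = here refl
∈-subconcepts ｛ι C ｝    = here refl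
∈-subconcepts (ι C ∙ D)  = here refl

length-++-≤ : ∀ {A : Set} (xs : List A) {ys : List A} {m n} →
              length xs ≤ m → length ys ≤ n → length (xs ++ ys) ≤ m + n
length-++-≤ xs xs≤m ys≤n = ≤-trans (≤-reflexive (length-++ xs)) (+-mono-≤ xs≤m ys≤n)

length-subconcepts≤size : ∀ C → length (subconcepts C) ≤ size C
length-subconcepts≤size (atom A)   = ≤-refl
length-subconcepts≤size (¬c C)     = s≤s (length-subconcepts≤size C)
length-subconcepts≤size (C ⊓ D)    =
  s≤s (length-++-≤ (subconcepts C) (length-subconcepts≤size C) (length-subconcepts≤size D))
length-subconcepts≤size (∃[ r ] C) = s≤s (≤-trans (length-subconcepts≤size C) (m≤n+m _ 2))
length-subconcepts≤size ｛ι C ｝    = s≤s (≤-trans (length-subconcepts≤size C) (m≤n+m _ 2))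
length-subconcepts≤size (ι C ∙ D)  =
  s≤s (≤-trans (length-++-≤ (subconcepts C) (length-subconcepts≤size C) (length-subconcepts≤size D))
               (m≤n+m _ 1))

length-concatMap-≤ : ∀ {A B : Set} (f : A → List B) {k} → (∀ x → length (f x) ≤ k) →
                     ∀ xs → length (concatMap f xs) ≤ k * length xs
length-concatMap-≤ f f≤k []       = z≤n
length-concatMap-≤ f {k} f≤k (x ∷ xs) = begin
  length (f x ++ concatMap f xs) ≤⟨ length-++-≤ (f x) (f≤k x) (length-concatMap-≤ f f≤k xs) ⟩
  k + k * length xs               ≡⟨ sym (*-suc k (length xs)) ⟩
  k * suc (length xs)             ∎
  where open ≤-Reasoning

lookup-injective : ∀ {A : Set} {xs : List A} → Unique xs → Injective _≡_ _≡_ (lookup xs)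
lookup-injective {xs = _ ∷ _} _ {zero} {zero} _ = refl
lookup-injective {xs = _ ∷ _} (x∉ ∷ _) {zero} {suc j} eq = contradiction eq (All.lookup x∉ (∈-lookup j))
lookup-injective {xs = _ ∷ _} (x∉ ∷ _) {suc i} {zero} eq = contradiction (sym eq) (All.lookup x∉ (∈-lookup i))
lookup-injective {xs = _ ∷ _} (_ ∷ u) {suc i} {suc j} eq = cong suc (lookup-injective u eq)

∈⇒lookup : ∀ {A : Set} {xs : List A} {x} → x ∈ xs → ∃ λ i → lookup xs i ≡ x
∈⇒lookup x∈xs = index x∈xs , sym (lookup-index x∈xs)

combine-injective : ∀ {m n} (i i′ : Fin m) {j j′ : Fin n} →
                    combine i j ≡ combine i′ j′ → i ≡ i′ × j ≡ j′
combine-injective {n = n} i i′ {j} {j′} eq with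
  trans (sym (remQuot-combine i j)) (trans (cong (remQuot n) eq) (remQuot-combine i′ j′))
... | refl = refl , refl

record TwoSample {Δ : Set} (P : Δ → Set) : Set where
  field
    elements     : List Δ
    length≤2     : length elements ≤ 2
    sound        : ∀ {z} → z ∈ elements → P z
    inhabited    : ∀ {x} → P x → ∃ λ z → z ∈ elements
    two-distinct : ∀ {x y} → x ≢ y → P x → P y →
                   ∃₂ λ z z′ → z ≢ z′ × z ∈ elements × z′ ∈ elements
open TwoSample

twoSample : ExcludedMiddle 0ℓ → {Δ : Set} (P : Δ → Set) → TwoSample P
twoSample em P with em {∃₂ λ x y → x ≢ y × P x × P y}
... | yes (x , y , x≢y , px , py) = record
  { elements     = x ∷ y ∷ []
  ; length≤2     = ≤-refl
  ; sound        = λ { (here refl) → px ; (there (here refl)) → py }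
  ; inhabited    = λ _ → x , here refl
  ; two-distinct = λ _ _ _ → x , y , x≢y , here refl , there (here refl)
  }
... | no ¬two with em {∃ P}
...   | yes (x , px) = record
  { elements     = x ∷ []
  ; length≤2     = s≤s z≤n
  ; sound        = λ { (here refl) → px }
  ; inhabited    = λ _ → x , here refl
  ; two-distinct = λ x≢y px py → contradiction (_ , _ , x≢y , px , py) ¬two
  }
...   | no ¬one = record
  { elements     = []
  ; length≤2     = z≤n
  ; sound        = λ ()
  ; inhabited    = λ px → contradiction (_ , px) ¬one
  ; two-distinct = λ _ px _ → contradiction (_ , px) ¬one
  }

module Representatives (em : ExcludedMiddle 0ℓ) {Δ : Set} {k : ℕ} (τ : Δ → Fin k) where

  _≟_ : (x y : Δ) → Dec (x ≡ y)
  x ≟ y = em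

  fibreSample : (t : Fin k) → TwoSample (λ x → τ x ≡ t)
  fibreSample t = twoSample em (λ x → τ x ≡ t)

  samples : List Δ
  samples = concatMap (elements ∘ fibreSample) (allFin k)

  representatives : List Δ
  representatives = deduplicate _≟_ samples

  n : ℕ
  n = length representatives

  rep : Fin n → Δ
  rep = lookup representatives

  rep-injective : Injective _≡_ _≡_ rep
  rep-injective = lookup-injective (deduplicate-! _≟_ samples)

  n≤2*k : n ≤ 2 * k
  n≤2*k = begin
    n                     ≤⟨ length-deduplicate _≟_ samples ⟩
    length samples        ≤⟨ length-concatMap-≤ _ (length≤2 ∘ fibreSample) (allFin k) ⟩
    2 * length (allFin k) ≡⟨ cong (2 *_) (length-tabulate {n = k} id) ⟩
    2 * k                 ∎
    where open ≤-Reasoning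

  ∈-representatives : ∀ {t z} → z ∈ elements (fibreSample t) → ∃ λ q → rep q ≡ z
  ∈-representatives {t} z∈ = ∈⇒lookup (∈-deduplicate⁺ _≟_ (∈-concat⁺′ z∈ (∈-map⁺ _ (∈-allFin t))))

  rep-covers : ∀ x → ∃ λ q → τ (rep q) ≡ τ x
  rep-covers x with inhabited (fibreSample (τ x)) refl
  ... | z , z∈ with ∈-representatives z∈
  ... | q , refl = q , sound (fibreSample (τ x)) z∈

  rep-covers-twice : ∀ {x y} → x ≢ y → τ x ≡ τ y →
                     ∃₂ λ q q′ → q ≢ q′ × τ (rep q) ≡ τ x × τ (rep q′) ≡ τ x
  rep-covers-twice x≢y τx≡τy with two-distinct (fibreSample _) x≢y refl (sym τx≡τy)
  ... | z , z′ , z≢z′ , z∈ , z′∈ with ∈-representatives z∈ | ∈-representatives z′∈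
  ... | q , refl | q′ , refl =
    q , q′ , z≢z′ ∘ cong rep , sound (fibreSample _) z∈ , sound (fibreSample _) z′∈

truthValue : ∀ {P : Set} → Dec P → Fin 2
truthValue (yes _) = suc zero
truthValue (no _)  = zero

truthValue-transfer : ∀ {P Q : Set} (p? : Dec P) (q? : Dec Q) → truthValue p? ≡ truthValue q? → P → Q
truthValue-transfer _       (yes q) _ _ = q
truthValue-transfer (no ¬p) (no _)  _ p = contradiction p ¬p

-- The binary number whose digits record which concepts of L hold at x.
type : ExcludedMiddle 0ℓ → {Δ : Set} → Interp Δ → (L : List Concept) → Δ → Fin (2 ^ length L)
type em I []      x = zero
type em I (E ∷ L) x = combine (truthValue (em {⟦ E ⟧ I x})) (type em I L x)

type-transfer : (em : ExcludedMiddle 0ℓ) {Δ : Set} (I : Interp Δ) (L : List Concept) {E : Concept} →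
                ∀ {x y} → E ∈ L → type em I L x ≡ type em I L y → ⟦ E ⟧ I x → ⟦ E ⟧ I y
type-transfer em {Δ} I (E ∷ L) {E′} {x} {y} E′∈ eq =
  split E′∈ (combine-injective (truthValueAt x) (truthValueAt y) eq)
  where
  truthValueAt : Δ → Fin 2
  truthValueAt z = truthValue (em {⟦ E ⟧ I z})
  split : E′ ∈ E ∷ L → truthValueAt x ≡ truthValueAt y × type em I L x ≡ type em I L y →
          ⟦ E′ ⟧ I x → ⟦ E′ ⟧ I y
  split (here refl)  (head≡ , _) = truthValue-transfer (em {⟦ E ⟧ I x}) (em {⟦ E ⟧ I y}) head≡
  split (there E′∈L) (_ , tail≡) = type-transfer em I L E′∈L tail≡

module Filtration (em : ExcludedMiddle 0ℓ) {Δ : Set} (I : Interp Δ) (L : List Concept)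
  {T : Set} (τ : Δ → T) (τ-transfer : ∀ {E x y} → E ∈ L → τ x ≡ τ y → ⟦ E ⟧ I x → ⟦ E ⟧ I y)
  {D : Set} (w : D → Δ) (w-injective : Injective _≡_ _≡_ w)
  (covers : ∀ x → ∃ λ q → τ (w q) ≡ τ x)
  (covers-twice : ∀ {x y} → x ≢ y → τ x ≡ τ y → ∃₂ λ q q′ → q ≢ q′ × τ (w q) ≡ τ x × τ (w q′) ≡ τ x)
  where

  J : Interp D
  J = record
    { conceptI = λ A q → conceptI I A (w q)
    ; roleI    = λ r p q → ∃₂ λ x y → τ x ≡ τ (w p) × τ y ≡ τ (w q) × roleI I r x y
    }

  isSingleton-filtration : ∀ {P : D → Set} {Q : Δ → Set} → (∀ {x y} → τ x ≡ τ y → Q x → Q y) →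
                           (∀ q → P q ⇔ Q (w q)) → ∀ q → IsSingleton P q ⇔ IsSingleton Q (w q)
  isSingleton-filtration {P} {Q} Q-transfer P⇔Q q = mk⇔ singletonI singletonJ
    where
    singletonI : IsSingleton P q → IsSingleton Q (w q)
    singletonI (Pq , P-unique) = to (P⇔Q q) Pq , Q-unique
      where
      Q-unique : ∀ y → Q y → y ≡ w q
      Q-unique y Qy with em {y ≡ w q}
      ... | yes y≡wq = y≡wq
      ... | no y≢wq =
        let q₁ , q₂ , q₁≢q₂ , τq₁ , τq₂ = covers-twice y≢wq τy≡τwq
        in contradiction (trans (only-q q₁ τq₁) (sym (only-q q₂ τq₂))) q₁≢q₂
        where
        only-q : ∀ p → τ (w p) ≡ τ y → p ≡ q
        only-q p τp = P-unique p (from (P⇔Q p) (Q-transfer (sym τp) Qy))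
        τy≡τwq : τ y ≡ τ (w q)
        τy≡τwq = let p , τp = covers y in trans (sym τp) (cong (τ ∘ w) (only-q p τp))
    singletonJ : IsSingleton Q (w q) → IsSingleton P q
    singletonJ (Qwq , Q-unique) = from (P⇔Q q) Qwq , λ p Pp → w-injective (Q-unique (w p) (to (P⇔Q p) Pp))

  filtration : ∀ E → subconcepts E ⊆ L → ∀ q → ⟦ E ⟧ J q ⇔ ⟦ E ⟧ I (w q)
  filtration (atom A)   _   q = mk⇔ id id
  filtration (¬c E)     sub q = mk⇔ (λ ¬EJ EI → ¬EJ (from ih EI)) (λ ¬EI EJ → ¬EI (to ih EJ))
    where
    ih : ⟦ E ⟧ J q ⇔ ⟦ E ⟧ I (w q)
    ih = filtration E (sub ∘ there) q
  filtration (E ⊓ F)    sub q =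
    filtration E (sub ∘ there ∘ ∈-++⁺ˡ) q ×-⇔ filtration F (sub ∘ there ∘ ∈-++⁺ʳ (subconcepts E)) q
  filtration (∃[ r ] E) sub q = mk⇔ successorI successorJ
    where
    ih : ∀ p → ⟦ E ⟧ J p ⇔ ⟦ E ⟧ I (w p)
    ih = filtration E (sub ∘ there)
    E∈L : E ∈ L
    E∈L = sub (there (∈-subconcepts E))
    successorI : ⟦ ∃[ r ] E ⟧ J q → ⟦ ∃[ r ] E ⟧ I (w q)
    successorI (p , (x , y , τx , τy , rxy) , Ep) =
      τ-transfer (sub (here refl)) τx (y , rxy , τ-transfer E∈L (sym τy) (to (ih p) Ep))
    successorJ : ⟦ ∃[ r ] E ⟧ I (w q) → ⟦ ∃[ r ] E ⟧ J q
    successorJ (y , rxy , Ey) =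
      let p , τp = covers y
      in p , (w q , y , refl , sym τp , rxy) , from (ih p) (τ-transfer E∈L (sym τp) Ey)
  filtration ｛ι E ｝ sub =
    isSingleton-filtration (τ-transfer (sub (there (∈-subconcepts E)))) (filtration E (sub ∘ there))
  filtration (ι E ∙ F)  sub q = mk⇔ descriptionI descriptionJ
    where
    ihE : ∀ p → ⟦ E ⟧ J p ⇔ ⟦ E ⟧ I (w p)
    ihE = filtration E (sub ∘ there ∘ ∈-++⁺ˡ)
    ihF : ∀ p → ⟦ F ⟧ J p ⇔ ⟦ F ⟧ I (w p)
    ihF = filtration F (sub ∘ there ∘ ∈-++⁺ʳ (subconcepts E))
    E∈L : E ∈ L
    E∈L = sub (there (∈-++⁺ˡ (∈-subconcepts E)))
    singleton : ∀ p → IsSingleton (⟦ E ⟧ J) p ⇔ IsSingleton (⟦ E ⟧ I) (w p)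
    singleton = isSingleton-filtration (τ-transfer E∈L) ihE
    descriptionI : ⟦ ι E ∙ F ⟧ J q → ⟦ ι E ∙ F ⟧ I (w q)
    descriptionI (p , E!p , Fp) = w p , to (singleton p) E!p , to (ihF p) Fp
    descriptionJ : ⟦ ι E ∙ F ⟧ I (w q) → ⟦ ι E ∙ F ⟧ J q
    descriptionJ (y , E!y@(Ey , E-unique) , Fy) with covers y
    ... | p , τp with E-unique (w p) (τ-transfer E∈L (sym τp) Ey)
    ... | refl = p , from (singleton p) E!y , from (ihF p) Fy

small-model : ExcludedMiddle 0ℓ → ∀ C → Satisfiable C →
              ∃ λ n → n ≤ 2 * 2 ^ length (subconcepts C) × Σ (Interp (Fin n)) λ J → ∃ λ q → ⟦ C ⟧ J q
small-model em C (Δ , I , d , Cd) =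
  n , n≤2*k , J , q , from (filtration C id q) (type-transfer em I L (∈-subconcepts C) (sym τq) Cd)
  where
  L : List Concept
  L = subconcepts C
  open Representatives em (type em I L)
  open Filtration em I L (type em I L) (type-transfer em I L) rep rep-injective rep-covers rep-covers-twice
  q : Fin n
  q = proj₁ (rep-covers d)
  τq : type em I L (rep q) ≡ type em I L d
  τq = proj₂ (rep-covers d)

size-nonZero : ∀ C → NonZero (size C)
size-nonZero (atom A)   = _
size-nonZero (¬c C)     = _
size-nonZero (C ⊓ D)    = _
size-nonZero (∃[ r ] C) = _
size-nonZero ｛ι C ｝    = _
size-nonZero (ι C ∙ D)  = _

1+n≤2*n^2 : ∀ n .{{_ : NonZero n}} → 1 + n ≤ 2 * n ^ 2
1+n≤2*n^2 n = begin
  1 + n        ≤⟨ +-monoˡ-≤ n (>-nonZero⁻¹ n) ⟩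
  n + n        ≡⟨ cong (n +_) (sym (+-identityʳ n)) ⟩
  2 * n        ≤⟨ *-monoʳ-≤ 2 (m≤m*n n n) ⟩
  2 * (n * n)  ≡⟨ cong (λ m → 2 * (n * m)) (sym (*-identityʳ n)) ⟩
  2 * n ^ 2    ∎
  where open ≤-Reasoning

theorem9 : ExcludedMiddle 0ℓ →
    ∃ λ (k : ℕ) → ∀ (C : Concept) → Satisfiable C →
      ∃ λ (n : ℕ) → n ≤ 2 ^ (k * size C ^ k) ×
        Σ (Interp (Fin n)) λ I → ∃ λ d → ⟦ C ⟧ I d
theorem9 em = 2 , bounded-model
  where
  exponent-bound : ∀ C → 1 + length (subconcepts C) ≤ 2 * size C ^ 2
  exponent-bound C = ≤-trans (s≤s (length-subconcepts≤size C)) (1+n≤2*n^2 (size C) {{size-nonZero C}})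
  bounded-model : ∀ C → Satisfiable C →
                  ∃ λ n → n ≤ 2 ^ (2 * size C ^ 2) × Σ (Interp (Fin n)) λ I → ∃ λ d → ⟦ C ⟧ I d
  bounded-model C sat =
    let n , n≤ , model = small-model em C sat
    in n , ≤-trans n≤ (^-monoʳ-≤ 2 (exponent-bound C)) , model
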